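{- Let $k,\ell$ be positive integers with $k \ge 5$, set $s = \nu_2(k!) + \ell - b_k - 3$, and define $$f_k(n) = \sum_{i=1}^{\lceil k/2\rceil} \binom{k}{t_i} t_i^{\,n}\left(t_i^{2^{s+1}} - 1\right), \qquad t_i = 2i-1.$$ Then for every integer $n \ge k$ the following are equivalent: (i) $f_k(n) \equiv 0 \pmod{2^{2s+4}}$; (ii) $S([n]_{2^m},k)$ is constant modulo $2^{m-b_k+\ell}$ for all integers $m \ge s+1$ with $2^m - m \ge s+3$; (iii) $S([n]_{2^m},k)$ is constant modulo $2^{m-b_k+\ell}$ for some integer $m \ge s+1$ with $2^m - m \ge s+3$.
   Context: $S(n,k)$ denotes the Stirling number of the second kind. $\nu_2(z)$ is the exponent of the largest power of $2$ dividing the positive integer $z$. $b_k = \lceil \log_2 k\rceil - 2$. For $n,t\in\mathbb{N}$, $[n]_t = \{ j \in \mathbb{N} : j \ge \max\{n,t\},\ j \equiv n \pmod t\}$, and $S([n]_t,k)=\{S(j,k): j\in[n]_t\}$. A set of integers is constant modulo $Q$ if all its elements are congruent to one another modulo $Q$. -}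

module Defs where

open import Data.Nat as ℕ using (ℕ; zero; suc; _+_; _*_; _∸_; _^_; _≤_; _⊔_; _!)
open import Data.Nat.Combinatorics using (_C_)
open import Data.Nat.Logarithm using (⌈log₂_⌉)
open import Data.Nat.Divisibility using (_∣?_)
open import Data.Integer as ℤ using (ℤ; +_)
open import Data.Integer.Divisibility as ℤD using ()
open import Data.List using (List; map; upTo; foldr)
open import Relation.Nullary.Decidable using (does)
open import Data.Bool using (if_then_else_)

S : ℕ → ℕ → ℕ
S zero    zero    = 1
S zero    (suc k) = 0
S (suc n) zero    = 0
S (suc n) (suc k) = suc k * S n (suc k) + S n k

-- 2-adic valuation with fuel; ν₂ z is correct for every positive z
-- (fuel z suffices since each step halves z). Convention ν₂ 0 = 0 (never used).
ν₂-fuel : ℕ → ℕ → ℕ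
ν₂-fuel zero    z       = 0
ν₂-fuel (suc f) zero    = 0
ν₂-fuel (suc f) (suc z) =
  if does (2 ∣? suc z) then suc (ν₂-fuel f (ℕ._/_ (suc z) 2)) else 0

ν₂ : ℕ → ℕ
ν₂ z = ν₂-fuel z z

-- b_k = ⌈log₂ k⌉ - 2  (only used for k ≥ 5, where it is ≥ 1, so truncation is harmless)
b : ℕ → ℕ
b k = ⌈log₂ k ⌉ ∸ 2

-- s = ν₂(k!) + ℓ - b_k - 3 (nonnegative for k ≥ 5, ℓ ≥ 1)
s : ℕ → ℕ → ℕ
s k ℓ = (ν₂ (k !) + ℓ) ∸ (b k + 3)

ceilHalf : ℕ → ℕ
ceilHalf k = ℕ._/_ (k + 1) 2

f : ℕ → ℕ → ℕ → ℤ
f k ℓ n = foldr ℤ._+_ (+ 0) (map term (upTo (ceilHalf k)))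
  where
  -- i' = i - 1 ranges over 0 .. ⌈k/2⌉-1, so t = 2 i' + 1 = 2i - 1
  term : ℕ → ℤ
  term i' = let t = 2 * i' + 1 in
    (+ (k C t)) ℤ.* (+ (t ^ n)) ℤ.* ((+ (t ^ (2 ^ (s k ℓ + 1)))) ℤ.- + 1)

_≡_[mod_] : ℕ → ℕ → ℕ → Set
a ≡ c [mod Q ] = (+ Q) ℤD.∣ ((+ a) ℤ.- (+ c))

_∈[_]_ : ℕ → ℕ → ℕ → Set
j ∈[ n ] t = (n ⊔ t ≤ j) Data.Product.× (j ≡ n [mod t ])
  where import Data.Product

ConstMod : ℕ → ℕ → ℕ → ℕ → Set
ConstMod n t k Q = ∀ j j′ → j ∈[ n ] t → j′ ∈[ n ] t → S j k ≡ S j′ k [mod Q ]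

Admissible : ℕ → ℕ → ℕ → Set
Admissible k ℓ m = (s k ℓ + 1 ≤ m) Data.Product.× (m + (s k ℓ + 3) ≤ 2 ^ m)
  where import Data.Product

-- Write k!·S(j,k) = Δᵏ(t ↦ tʲ)(0) and g(m) = Δᵏ(t ↦ [t odd]·tⁿ·(t^(2^m) − 1))(0). For odd t,
-- t^(2^(m+1)) ≡ 1 (mod 2^(m+3)), so expanding tʲ = tⁿ·(1 + (t^(2^(m+1)) − 1))^r for
-- j = n + 2^(m+1)·r gives k!·S(j,k) ≡ Δᵏ([t odd]·tⁿ)(0) + r·g(m+1) modulo 2^E whenever
-- E ≤ 2m + 6 and E ≤ j (even t contribute tʲ ≡ 0). Cancelling k! = 2^ν₂(k!)·odd, the set
-- S([n]_(2^m), k) is constant modulo 2^(m+ℓ−b_k) iff 2^(m+s+3) ∣ g(m); the bound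
-- ν₂(k!) ≥ 2b_k + 1, from 2^(2^c) ∣ 2·(2^c)! with 2^c ≤ k < 2^(c+1), makes the exponents match.
-- Squaring gives g(m+1) ≡ 2·g(m) modulo 2^(2m+4), so this condition is the same for every
-- admissible m, and at m = s + 1 it reads 2^(2s+4) ∣ g(s+1) = ±f_k(n).

module Submission where

module Sums where
  open import Data.Integer using (ℤ; _+_; _-_; _*_; 0ℤ)
  open import Data.Integer.Properties using (+-identityˡ; *-zeroʳ)
  open import Data.Integer.Tactic.RingSolver using (solve-∀)
  import Data.Nat as ℕ
  open ℕ using (ℕ; zero; suc)
  open import Data.Nat.Properties using (*-suc)
  open import Data.List using (map; foldr; applyUpTo; upTo)
  open import Function using (_∘_; id)
  open import Relation.Binary.PropositionalEquality

  ∑ : ℕ → (ℕ → ℤ) → ℤ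
  ∑ zero    g = 0ℤ
  ∑ (suc N) g = g 0 + ∑ N (g ∘ suc)

  foldr-map-upTo≡∑ : ∀ N (g : ℕ → ℤ) → foldr _+_ 0ℤ (map g (upTo N)) ≡ ∑ N g
  foldr-map-upTo≡∑ N g = go N id
    where
    go : ∀ N (e : ℕ → ℕ) → foldr _+_ 0ℤ (map g (applyUpTo e N)) ≡ ∑ N (g ∘ e)
    go zero    e = refl
    go (suc N) e = cong (g (e 0) +_) (go N (e ∘ suc))

  ∑-cong : ∀ N {g h : ℕ → ℤ} → (∀ i → g i ≡ h i) → ∑ N g ≡ ∑ N h
  ∑-cong zero    g≡h = refl
  ∑-cong (suc N) g≡h = cong₂ _+_ (g≡h 0) (∑-cong N (g≡h ∘ suc))

  ∑-zero : ∀ N {g : ℕ → ℤ} → (∀ i → g i ≡ 0ℤ) → ∑ N g ≡ 0ℤ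
  ∑-zero zero    g≡0 = refl
  ∑-zero (suc N) g≡0 = cong₂ _+_ (g≡0 0) (∑-zero N (g≡0 ∘ suc))

  ∑-scale : ∀ N (g : ℕ → ℤ) c → ∑ N (λ i → c * g i) ≡ c * ∑ N g
  ∑-scale zero    g c = sym (*-zeroʳ c)
  ∑-scale (suc N) g c =
    trans (cong (c * g 0 +_) (∑-scale N (g ∘ suc) c)) (factor c (g 0) (∑ N (g ∘ suc)))
    where
    factor : ∀ c x y → c * x + c * y ≡ c * (x + y)
    factor = solve-∀

  ∑-sub : ∀ N (g h : ℕ → ℤ) → ∑ N (λ i → g i - h i) ≡ ∑ N g - ∑ N h
  ∑-sub zero    g h = refl
  ∑-sub (suc N) g h =
    trans (cong (g 0 - h 0 +_) (∑-sub N (g ∘ suc) (h ∘ suc)))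
          (regroup (g 0) (h 0) (∑ N (g ∘ suc)) (∑ N (h ∘ suc)))
    where
    regroup : ∀ a b c d → (a - b) + (c - d) ≡ (a + c) - (b + d)
    regroup = solve-∀

  ∑-odd : ∀ M (g : ℕ → ℤ) → (∀ u → g (2 ℕ.* u) ≡ 0ℤ) →
    ∑ (suc (2 ℕ.* M)) g ≡ ∑ M (λ u → g (suc (2 ℕ.* u)))
  ∑-odd zero    g g-even≡0 = cong (_+ 0ℤ) (g-even≡0 0)
  ∑-odd (suc M) g g-even≡0 = begin
    ∑ (suc (2 ℕ.* suc M)) g
      ≡⟨ cong (λ z → ∑ (suc z) g) (*-suc 2 M) ⟩
    g 0 + (g 1 + ∑ (suc (2 ℕ.* M)) (g ∘ suc ∘ suc))
      ≡⟨ cong (_+ (g 1 + ∑ (suc (2 ℕ.* M)) (g ∘ suc ∘ suc))) (g-even≡0 0) ⟩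
    0ℤ + (g 1 + ∑ (suc (2 ℕ.* M)) (g ∘ suc ∘ suc))
      ≡⟨ +-identityˡ _ ⟩
    g 1 + ∑ (suc (2 ℕ.* M)) (g ∘ suc ∘ suc)
      ≡⟨ cong (g 1 +_) (∑-odd M (g ∘ suc ∘ suc) shifted-even≡0) ⟩
    g 1 + ∑ M (λ u → g (suc (suc (suc (2 ℕ.* u)))))
      ≡⟨ cong (g 1 +_) (∑-cong M (λ u → cong (g ∘ suc) (sym (*-suc 2 u)))) ⟩
    ∑ (suc M) (λ u → g (suc (2 ℕ.* u)))
      ∎
    where
    open ≡-Reasoning
    shifted-even≡0 : ∀ u → g (suc (suc (2 ℕ.* u))) ≡ 0ℤ
    shifted-even≡0 u = trans (cong g (sym (*-suc 2 u))) (g-even≡0 (suc u))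

module FiniteDifferences where
  open import Data.Integer using (ℤ; +_; -_; _+_; _-_; _*_; _^_; 0ℤ; 1ℤ; -1ℤ)
  open import Data.Integer.Properties using (pos-+; pos-*; +-assoc; +-identityˡ; +-inverseʳ; *-zeroʳ)
  open import Data.Integer.Divisibility.Signed using (_∣_; ∣m∣n⇒∣m-n)
  open import Data.Integer.Tactic.RingSolver using (solve-∀)
  import Data.Nat as ℕ
  open ℕ using (ℕ; zero; suc; _!; _<_; s≤s)
  import Data.Nat.Properties as ℕ
  import Data.Nat.Tactic.RingSolver as ℕ
  open import Data.Nat.Combinatorics using (_C_; nCk+nC[k+1]≡[n+1]C[k+1])
  open import Function using (_∘_)
  open import Relation.Binary.PropositionalEquality
  open import Defs using (S)
  open Sums

  Δ : ℕ → (ℕ → ℤ) → ℤ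
  Δ zero    h = h 0
  Δ (suc k) h = Δ k (h ∘ suc) - Δ k h

  Δ-cong : ∀ k {g h : ℕ → ℤ} → (∀ i → g i ≡ h i) → Δ k g ≡ Δ k h
  Δ-cong zero    g≡h = g≡h 0
  Δ-cong (suc k) g≡h = cong₂ _-_ (Δ-cong k (g≡h ∘ suc)) (Δ-cong k g≡h)

  Δ-linear : ∀ k (g h : ℕ → ℤ) c → Δ k (λ i → g i + c * h i) ≡ Δ k g + c * Δ k h
  Δ-linear zero    g h c = refl
  Δ-linear (suc k) g h c =
    trans (cong₂ _-_ (Δ-linear k (g ∘ suc) (h ∘ suc) c) (Δ-linear k g h c))
          (regroup (Δ k (g ∘ suc)) (Δ k g) (Δ k (h ∘ suc)) (Δ k h) c)
    where
    regroup : ∀ a b x y c → (a + c * x) - (b + c * y) ≡ (a - b) + c * (x - y)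
    regroup = solve-∀

  Δ-scale : ∀ k (h : ℕ → ℤ) c → Δ k (λ i → c * h i) ≡ c * Δ k h
  Δ-scale zero    h c = refl
  Δ-scale (suc k) h c =
    trans (cong₂ _-_ (Δ-scale k (h ∘ suc) c) (Δ-scale k h c)) (factor c (Δ k (h ∘ suc)) (Δ k h))
    where
    factor : ∀ c x y → c * x - c * y ≡ c * (x - y)
    factor = solve-∀

  Δ-cong-∣ : ∀ k {M} {g h : ℕ → ℤ} → (∀ i → M ∣ g i - h i) → M ∣ Δ k g - Δ k h
  Δ-cong-∣ zero    M∣g-h = M∣g-h 0
  Δ-cong-∣ (suc k) {M} {g} {h} M∣g-h =
    subst (M ∣_) (swap (Δ k (g ∘ suc)) (Δ k g) (Δ k (h ∘ suc)) (Δ k h))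
      (∣m∣n⇒∣m-n (Δ-cong-∣ k (M∣g-h ∘ suc)) (Δ-cong-∣ k M∣g-h))
    where
    swap : ∀ a b c d → (a - c) - (b - d) ≡ (a - b) - (c - d)
    swap = solve-∀

  Δ-leibniz : ∀ k c (h : ℕ → ℤ) →
    Δ (suc k) (λ i → (c + + i) * h i) ≡ c * Δ (suc k) h + + suc k * Δ k (h ∘ suc)
  Δ-leibniz zero    c h = expand c (h 0) (h 1)
    where
    expand : ∀ c x y → (c + 1ℤ) * y - (c + 0ℤ) * x ≡ c * (y - x) + 1ℤ * y
    expand = solve-∀
  Δ-leibniz (suc k) c h = begin
    Δ (suc k) (λ i → (c + + suc i) * h (suc i)) - Δ (suc k) (λ i → (c + + i) * h i)
      ≡⟨ cong (_- Δ (suc k) (λ i → (c + + i) * h i)) (Δ-cong (suc k) shift) ⟩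
    Δ (suc k) (λ i → ((c + 1ℤ) + + i) * h (suc i)) - Δ (suc k) (λ i → (c + + i) * h i)
      ≡⟨ cong₂ _-_ (Δ-leibniz k (c + 1ℤ) (h ∘ suc)) (Δ-leibniz k c h) ⟩
    ((c + 1ℤ) * Δ (suc k) (h ∘ suc) + + suc k * Δ k (h ∘ suc ∘ suc))
      - (c * Δ (suc k) h + + suc k * Δ k (h ∘ suc))
      ≡⟨ collect c (Δ (suc k) h) (Δ k (h ∘ suc ∘ suc)) (Δ k (h ∘ suc)) (+ suc k) ⟩
    c * Δ (suc (suc k)) h + (1ℤ + + suc k) * Δ (suc k) (h ∘ suc)
      ∎
    where
    open ≡-Reasoning
    shift : ∀ i → (c + + suc i) * h (suc i) ≡ ((c + 1ℤ) + + i) * h (suc i)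
    shift i = cong (_* h (suc i)) (trans (cong (_+_ c) (pos-+ 1 i)) (sym (+-assoc c 1ℤ (+ i))))
    collect : ∀ c y z w n →
      ((c + 1ℤ) * (z - w) + n * z) - (c * y + n * w) ≡ c * ((z - w) - y) + (1ℤ + n) * (z - w)
    collect = solve-∀

  Δ-pow≡k!S : ∀ n k → Δ k (λ i → (+ i) ^ n) ≡ + (k ! ℕ.* S n k)
  Δ-pow≡k!S zero    zero    = refl
  Δ-pow≡k!S zero    (suc k) =
    trans (+-inverseʳ (Δ k (λ _ → 1ℤ))) (cong +_ (sym (ℕ.*-zeroʳ (suc k !))))
  Δ-pow≡k!S (suc n) zero    = refl
  Δ-pow≡k!S (suc n) (suc k) = begin
    Δ (suc k) (λ i → + i * (+ i) ^ n)
      ≡⟨ Δ-cong (suc k) (λ i → cong (_* (+ i) ^ n) (sym (+-identityˡ (+ i)))) ⟩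
    Δ (suc k) (λ i → (0ℤ + + i) * (+ i) ^ n)
      ≡⟨ Δ-leibniz k 0ℤ (λ i → (+ i) ^ n) ⟩
    0ℤ * Δ (suc k) (λ i → (+ i) ^ n) + + suc k * Δ k (λ i → (+ suc i) ^ n)
      ≡⟨ unshift (Δ k (λ i → (+ suc i) ^ n)) (Δ k (λ i → (+ i) ^ n)) (+ suc k) ⟩
    + suc k * (Δ (suc k) (λ i → (+ i) ^ n) + Δ k (λ i → (+ i) ^ n))
      ≡⟨ cong (λ z → + suc k * z) (cong₂ _+_ (Δ-pow≡k!S n (suc k)) (Δ-pow≡k!S n k)) ⟩
    + suc k * (+ (suc k ! ℕ.* S n (suc k)) + + (k ! ℕ.* S n k))
      ≡⟨ sym (pos-* (suc k) (suc k ! ℕ.* S n (suc k) ℕ.+ k ! ℕ.* S n k)) ⟩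
    + (suc k ℕ.* (suc k ! ℕ.* S n (suc k) ℕ.+ k ! ℕ.* S n k))
      ≡⟨ cong +_ (stirling-step (suc k) (k !) (S n (suc k)) (S n k)) ⟩
    + (suc k ! ℕ.* S (suc n) (suc k))
      ∎
    where
    open ≡-Reasoning
    unshift : ∀ y x c → 0ℤ * (y - x) + c * y ≡ c * ((y - x) + x)
    unshift = solve-∀
    stirling-step : ∀ c f x y → c ℕ.* (c ℕ.* f ℕ.* x ℕ.+ f ℕ.* y) ≡ c ℕ.* f ℕ.* (c ℕ.* x ℕ.+ y)
    stirling-step = ℕ.solve-∀

  signedBinomial : ℕ → ℕ → ℤ
  signedBinomial k i = -1ℤ ^ (k ℕ.+ i) * + (k C i)

  signedBinomial-suc-zero : ∀ k → signedBinomial (suc k) 0 ≡ - signedBinomial k 0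
  signedBinomial-suc-zero k = negate (-1ℤ ^ (k ℕ.+ 0))
    where
    negate : ∀ p → -1ℤ * p * 1ℤ ≡ - (p * 1ℤ)
    negate = solve-∀

  signedBinomial-pascal : ∀ k i →
    signedBinomial (suc k) (suc i) ≡ signedBinomial k i - signedBinomial k (suc i)
  signedBinomial-pascal k i = begin
    -1ℤ * -1ℤ ^ (k ℕ.+ suc i) * + (suc k C suc i)
      ≡⟨ cong₂ (λ e c → -1ℤ * -1ℤ ^ e * + c) (ℕ.+-suc k i) (sym (nCk+nC[k+1]≡[n+1]C[k+1] k i)) ⟩
    -1ℤ * (-1ℤ * p) * + (k C i ℕ.+ k C suc i)
      ≡⟨ cong (-1ℤ * (-1ℤ * p) *_) (pos-+ (k C i) (k C suc i)) ⟩
    -1ℤ * (-1ℤ * p) * (+ (k C i) + + (k C suc i))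
      ≡⟨ expand p (+ (k C i)) (+ (k C suc i)) ⟩
    p * + (k C i) - -1ℤ * p * + (k C suc i)
      ≡⟨ cong (λ e → p * + (k C i) - -1ℤ ^ e * + (k C suc i)) (sym (ℕ.+-suc k i)) ⟩
    signedBinomial k i - signedBinomial k (suc i)
      ∎
    where
    open ≡-Reasoning
    p = -1ℤ ^ (k ℕ.+ i)
    expand : ∀ p a b → -1ℤ * (-1ℤ * p) * (a + b) ≡ p * a - -1ℤ * p * b
    expand = solve-∀

  Δ-explicit : ∀ k N (h : ℕ → ℤ) → k < N → Δ k h ≡ ∑ N (λ i → signedBinomial k i * h i)
  Δ-explicit zero    (suc N) h _ =
    sym (trans (cong (_+_ (1ℤ * h 0)) (∑-zero N (λ i → vanish (-1ℤ ^ suc i) (h (suc i)))))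
               (unit (h 0)))
    where
    vanish : ∀ p x → p * 0ℤ * x ≡ 0ℤ
    vanish = solve-∀
    unit : ∀ x → 1ℤ * x + 0ℤ ≡ x
    unit = solve-∀
  Δ-explicit (suc k) (suc N) h (s≤s k<N) = begin
    Δ k (h ∘ suc) - Δ k h
      ≡⟨ cong₂ _-_ (Δ-explicit k N (h ∘ suc) k<N) (Δ-explicit k (suc N) h (ℕ.m≤n⇒m≤1+n k<N)) ⟩
    ∑ N (λ i → c k i * h (suc i)) - (c k 0 * h 0 + ∑ N (λ i → c k (suc i) * h (suc i)))
      ≡⟨ regroup (c k 0) (h 0) (∑ N (λ i → c k i * h (suc i))) (∑ N (λ i → c k (suc i) * h (suc i))) ⟩
    - c k 0 * h 0 + (∑ N (λ i → c k i * h (suc i)) - ∑ N (λ i → c k (suc i) * h (suc i)))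
      ≡⟨ cong₂ _+_ (cong (_* h 0) (sym (signedBinomial-suc-zero k)))
                   (trans (sym (∑-sub N _ _)) (∑-cong N pascal-term)) ⟩
    c (suc k) 0 * h 0 + ∑ N (λ i → c (suc k) (suc i) * h (suc i))
      ∎
    where
    open ≡-Reasoning
    c = signedBinomial
    regroup : ∀ c₀ h₀ x y → x - (c₀ * h₀ + y) ≡ - c₀ * h₀ + (x - y)
    regroup = solve-∀
    pascal-term : ∀ i → c k i * h (suc i) - c k (suc i) * h (suc i) ≡ c (suc k) (suc i) * h (suc i)
    pascal-term i = trans (factor (c k i) (c k (suc i)) (h (suc i)))
                          (cong (_* h (suc i)) (sym (signedBinomial-pascal k i)))
      where
      factor : ∀ a b x → a * x - b * x ≡ (a - b) * x
      factor = solve-∀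

module TwoAdic where
  open import Data.Integer using (ℤ; +_; _+_; _-_; _*_; _^_; 0ℤ; 1ℤ)
  open import Data.Integer.Properties using (pos-*; *-comm; *-identityʳ; ^-distribˡ-+-*)
  open import Data.Integer.Divisibility.Signed
    using ( _∣_; divides; ∣-refl; ∣-trans; ∣m∣n⇒∣m+n; ∣m∣n⇒∣m-n; ∣m⇒∣m*n; ∣n⇒∣m*n
          ; *-monoʳ-∣; *-monoˡ-∣; *-cancelˡ-∣)
  open import Data.Integer.Tactic.RingSolver using (solve-∀)
  import Data.Nat as ℕ
  open ℕ using (ℕ; zero; suc; _≤_; z≤n; s≤s)
  import Data.Nat.Properties as ℕ
  open import Function using (_⇔_; mk⇔)
  open import Relation.Binary.PropositionalEquality

  data EvenOdd : ℕ → Set where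
    even : ∀ u → EvenOdd (2 ℕ.* u)
    odd  : ∀ u → EvenOdd (suc (2 ℕ.* u))

  evenOdd : ∀ t → EvenOdd t
  evenOdd zero          = even 0
  evenOdd (suc zero)    = odd 0
  evenOdd (suc (suc t)) with evenOdd t
  ... | even u = subst EvenOdd (ℕ.*-suc 2 u) (even (suc u))
  ... | odd u  = subst EvenOdd (cong suc (ℕ.*-suc 2 u)) (odd (suc u))

  pattern 2ℤ = + 2

  +[2*u]≡2ℤ*u : ∀ u → + (2 ℕ.* u) ≡ 2ℤ * + u
  +[2*u]≡2ℤ*u = pos-* 2

  +[1+2u]≡1+2ℤ*u : ∀ u → + suc (2 ℕ.* u) ≡ 1ℤ + 2ℤ * + u
  +[1+2u]≡1+2ℤ*u u = cong (_+_ 1ℤ) (+[2*u]≡2ℤ*u u)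

  pos-^ : ∀ m n → + (m ℕ.^ n) ≡ (+ m) ^ n
  pos-^ m zero    = refl
  pos-^ m (suc n) = trans (pos-* m (m ℕ.^ n)) (cong (+ m *_) (pos-^ m n))

  *-pres-∣ : ∀ {a b x y} → a ∣ x → b ∣ y → a * b ∣ x * y
  *-pres-∣ {a} {y = y} a∣x b∣y = ∣-trans (*-monoʳ-∣ a b∣y) (*-monoˡ-∣ y a∣x)

  2^-mono-∣ : ∀ {e e′} → e ≤ e′ → 2ℤ ^ e ∣ 2ℤ ^ e′
  2^-mono-∣ {e′ = e′} z≤n = divides (2ℤ ^ e′) (sym (*-identityʳ (2ℤ ^ e′)))
  2^-mono-∣ (s≤s e≤e′)    = *-monoʳ-∣ 2ℤ (2^-mono-∣ e≤e′)

  2^e∣[2y]^j : ∀ y {e j} → e ≤ j → 2ℤ ^ e ∣ (2ℤ * y) ^ j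
  2^e∣[2y]^j y {j = j} z≤n = divides ((2ℤ * y) ^ j) (sym (*-identityʳ _))
  2^e∣[2y]^j y (s≤s e≤j)   = *-pres-∣ {a = 2ℤ} (∣m⇒∣m*n y ∣-refl) (2^e∣[2y]^j y e≤j)

  2P∣x⇔P∣y : ∀ P x y → 2ℤ * P ∣ x - 2ℤ * y → (2ℤ * P ∣ x ⇔ P ∣ y)
  2P∣x⇔P∣y P x y 2P∣x-2y = mk⇔
    (λ 2P∣x → *-cancelˡ-∣ 2ℤ
      (subst (2ℤ * P ∣_) (cancel x (2ℤ * y)) (∣m∣n⇒∣m-n 2P∣x 2P∣x-2y)))
    (λ P∣y → subst (2ℤ * P ∣_) (restore x (2ℤ * y))
      (∣m∣n⇒∣m+n 2P∣x-2y (*-monoʳ-∣ 2ℤ P∣y)))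
    where
    cancel : ∀ x z → x - (x - z) ≡ z
    cancel = solve-∀
    restore : ∀ x z → (x - z) + z ≡ x
    restore = solve-∀

  [x-1]²∣xʳ-[1+r[x-1]] : ∀ x r → (x - 1ℤ) * (x - 1ℤ) ∣ x ^ r - (1ℤ + + r * (x - 1ℤ))
  [x-1]²∣xʳ-[1+r[x-1]] x zero    = divides 0ℤ (cancel x)
    where
    cancel : ∀ x → 1ℤ - (1ℤ + 0ℤ * (x - 1ℤ)) ≡ 0ℤ * ((x - 1ℤ) * (x - 1ℤ))
    cancel = solve-∀
  [x-1]²∣xʳ-[1+r[x-1]] x (suc r) =
    subst ((x - 1ℤ) * (x - 1ℤ) ∣_) (sym (step x (x ^ r) (+ r)))
      (∣m∣n⇒∣m+n (∣n⇒∣m*n x ([x-1]²∣xʳ-[1+r[x-1]] x r)) (∣n⇒∣m*n (+ r) ∣-refl))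
    where
    step : ∀ x p r → x * p - (1ℤ + (1ℤ + r) * (x - 1ℤ))
                   ≡ x * (p - (1ℤ + r * (x - 1ℤ))) + r * ((x - 1ℤ) * (x - 1ℤ))
    step = solve-∀

  defect : ℤ → ℕ → ℤ
  defect x m = x ^ (2 ℕ.^ m) - 1ℤ

  defect-suc : ∀ x m → defect x (suc m) ≡ defect x m * (defect x m + 2ℤ)
  defect-suc x m = begin
    x ^ (2 ℕ.^ m ℕ.+ (2 ℕ.^ m ℕ.+ 0)) - 1ℤ
      ≡⟨ cong (λ e → x ^ (2 ℕ.^ m ℕ.+ e) - 1ℤ) (ℕ.+-identityʳ (2 ℕ.^ m)) ⟩
    x ^ (2 ℕ.^ m ℕ.+ 2 ℕ.^ m) - 1ℤ
      ≡⟨ cong (_- 1ℤ) (^-distribˡ-+-* x (2 ℕ.^ m) (2 ℕ.^ m)) ⟩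
    x ^ 2 ℕ.^ m * x ^ 2 ℕ.^ m - 1ℤ
      ≡⟨ difference-of-squares (x ^ 2 ℕ.^ m) ⟩
    defect x m * (defect x m + 2ℤ)
      ∎
    where
    open ≡-Reasoning
    difference-of-squares : ∀ y → y * y - 1ℤ ≡ (y - 1ℤ) * ((y - 1ℤ) + 2ℤ)
    difference-of-squares = solve-∀

  8∣[1+2u]²-1 : ∀ u → 2ℤ ^ 3 ∣ defect (1ℤ + 2ℤ * + u) 1
  8∣[1+2u]²-1 u with evenOdd u
  ... | even v = divides (+ v * (1ℤ + 2ℤ * + v))
    (trans (cong (λ y → defect (1ℤ + 2ℤ * y) 1) (+[2*u]≡2ℤ*u v)) (even-case (+ v)))
    where
    even-case : ∀ y → let x = 1ℤ + 2ℤ * (2ℤ * y) in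
      x * (x * 1ℤ) - 1ℤ ≡ y * (1ℤ + 2ℤ * y) * (2ℤ * (2ℤ * (2ℤ * 1ℤ)))
    even-case = solve-∀
  ... | odd v = divides ((1ℤ + 2ℤ * + v) * (1ℤ + + v))
    (trans (cong (λ y → defect (1ℤ + 2ℤ * (1ℤ + y)) 1) (+[2*u]≡2ℤ*u v)) (odd-case (+ v)))
    where
    odd-case : ∀ y → let x = 1ℤ + 2ℤ * (1ℤ + 2ℤ * y) in
      x * (x * 1ℤ) - 1ℤ ≡ (1ℤ + 2ℤ * y) * (1ℤ + y) * (2ℤ * (2ℤ * (2ℤ * 1ℤ)))
    odd-case = solve-∀

  2^[3+m]∣defect-odd : ∀ u m → 2ℤ ^ (3 ℕ.+ m) ∣ defect (1ℤ + 2ℤ * + u) (suc m)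
  2^[3+m]∣defect-odd u zero    = 8∣[1+2u]²-1 u
  2^[3+m]∣defect-odd u (suc m) =
    subst₂ _∣_ (*-comm (2ℤ ^ (3 ℕ.+ m)) 2ℤ) (sym (defect-suc x (suc m)))
      (*-pres-∣ 2^[3+m]∣d (∣m∣n⇒∣m+n 2∣d ∣-refl))
    where
    x = 1ℤ + 2ℤ * + u
    2^[3+m]∣d = 2^[3+m]∣defect-odd u m
    2∣d : 2ℤ ∣ defect x (suc m)
    2∣d = ∣-trans (2^-mono-∣ {1} {3 ℕ.+ m} (s≤s z≤n)) 2^[3+m]∣d

  2^[6+2m]∣defect-odd² : ∀ u m →
    let d = defect (1ℤ + 2ℤ * + u) (suc m) in 2ℤ ^ ((3 ℕ.+ m) ℕ.+ (3 ℕ.+ m)) ∣ d * d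
  2^[6+2m]∣defect-odd² u m = subst (_∣ d * d) (sym (^-distribˡ-+-* 2ℤ (3 ℕ.+ m) (3 ℕ.+ m)))
    (*-pres-∣ (2^[3+m]∣defect-odd u m) (2^[3+m]∣defect-odd u m))
    where
    d = defect (1ℤ + 2ℤ * + u) (suc m)

module OddDifferences where
  open import Data.Integer using (ℤ; +_; _+_; _-_; _*_; _^_; 0ℤ; 1ℤ; -1ℤ)
  open import Data.Integer.Properties
    using (^-distribˡ-+-*; ^-*-assoc; ^-zeroˡ; *-assoc; *-identityˡ; *-identityʳ)
  open import Data.Integer.Divisibility.Signed
    using (_∣_; divides; ∣-trans; ∣n⇒∣m*n)
  open import Data.Integer.Tactic.RingSolver using (solve-∀)
  import Data.Nat as ℕ
  open ℕ using (ℕ; zero; suc; _!; _≤_; s≤s)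
  import Data.Nat.Properties as ℕ
  open import Data.Nat.DivMod using (m≡m%n+[m/n]*n; m%n<n)
  open import Data.Nat.Combinatorics using (_C_)
  open import Function using (_∘_; _⇔_; mk⇔)
  open import Relation.Binary.PropositionalEquality
  open import Defs using (S; f; s; ceilHalf)
  open Sums
  open FiniteDifferences
  open TwoAdic

  oddIndicator : ℕ → ℤ
  oddIndicator zero          = 0ℤ
  oddIndicator (suc zero)    = 1ℤ
  oddIndicator (suc (suc t)) = oddIndicator t

  oddIndicator-even : ∀ u → oddIndicator (2 ℕ.* u) ≡ 0ℤ
  oddIndicator-even zero    = refl
  oddIndicator-even (suc u) = trans (cong oddIndicator (ℕ.*-suc 2 u)) (oddIndicator-even u)

  oddIndicator-odd : ∀ u → oddIndicator (suc (2 ℕ.* u)) ≡ 1ℤ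
  oddIndicator-odd zero    = refl
  oddIndicator-odd (suc u) = trans (cong (oddIndicator ∘ suc) (ℕ.*-suc 2 u)) (oddIndicator-odd u)

  oddPow : ℕ → ℕ → ℤ
  oddPow n t = oddIndicator t * (+ t) ^ n

  Δodd : ℕ → ℕ → ℕ → ℤ
  Δodd k n m = Δ k (λ t → oddPow n t * defect (+ t) m)

  oddPow-shift : ∀ n m r t {E} → E ≤ n ℕ.+ 2 ℕ.^ suc m ℕ.* r → E ≤ (3 ℕ.+ m) ℕ.+ (3 ℕ.+ m) →
    2ℤ ^ E ∣ (+ t) ^ (n ℕ.+ 2 ℕ.^ suc m ℕ.* r)
             - (oddPow n t + + r * (oddPow n t * defect (+ t) (suc m)))
  oddPow-shift n m r t {E} E≤j E≤2[3+m] with evenOdd t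
  ... | even u rewrite oddIndicator-even u | +[2*u]≡2ℤ*u u =
    subst (2ℤ ^ E ∣_) (sym (drop-zeros (y ^ (n ℕ.+ 2 ℕ.^ suc m ℕ.* r)) (y ^ n) (defect y (suc m)) (+ r)))
      (2^e∣[2y]^j (+ u) E≤j)
    where
    y = 2ℤ * + u
    drop-zeros : ∀ x a d r → x - (0ℤ * a + r * (0ℤ * a * d)) ≡ x
    drop-zeros = solve-∀
  ... | odd u rewrite oddIndicator-odd u | +[1+2u]≡1+2ℤ*u u =
    subst (2ℤ ^ E ∣_) (sym split)
      (∣n⇒∣m*n (x ^ n) (∣-trans 2^E∣d² ([x-1]²∣xʳ-[1+r[x-1]] X r)))
    where
    x = 1ℤ + 2ℤ * + u
    X = x ^ 2 ℕ.^ suc m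
    2^E∣d² : 2ℤ ^ E ∣ (X - 1ℤ) * (X - 1ℤ)
    2^E∣d² = ∣-trans (2^-mono-∣ E≤2[3+m]) (2^[6+2m]∣defect-odd² u m)
    factor : ∀ a b d r → a * b - (1ℤ * a + r * (1ℤ * a * d)) ≡ a * (b - (1ℤ + r * d))
    factor = solve-∀
    split : x ^ (n ℕ.+ 2 ℕ.^ suc m ℕ.* r) - (1ℤ * x ^ n + + r * (1ℤ * x ^ n * defect x (suc m)))
          ≡ x ^ n * (X ^ r - (1ℤ + + r * (X - 1ℤ)))
    split = trans (cong (_- (1ℤ * x ^ n + + r * (1ℤ * x ^ n * defect x (suc m)))) xʲ≡xⁿ*Xʳ)
                  (factor (x ^ n) (X ^ r) (X - 1ℤ) (+ r))
      where
      xʲ≡xⁿ*Xʳ : x ^ (n ℕ.+ 2 ℕ.^ suc m ℕ.* r) ≡ x ^ n * X ^ r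
      xʲ≡xⁿ*Xʳ = trans (^-distribˡ-+-* x n (2 ℕ.^ suc m ℕ.* r))
                       (cong (x ^ n *_) (sym (^-*-assoc x (2 ℕ.^ suc m) r)))

  oddPow-defect-suc : ∀ n m t {E} → E ≤ (3 ℕ.+ m) ℕ.+ (3 ℕ.+ m) →
    2ℤ ^ E ∣ oddPow n t * defect (+ t) (2 ℕ.+ m) - 2ℤ * (oddPow n t * defect (+ t) (suc m))
  oddPow-defect-suc n m t {E} E≤2[3+m] =
    subst (2ℤ ^ E ∣_) (sym (trans (cong (λ e → a * e - 2ℤ * (a * d)) (defect-suc (+ t) (suc m)))
                                  (expand a d)))
      (∣-trans (2^-mono-∣ E≤2[3+m]) (2^[6+2m]∣oddPow*defect² t))
    where
    a = oddPow n t
    d = defect (+ t) (suc m)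
    expand : ∀ a d → a * (d * (d + 2ℤ)) - 2ℤ * (a * d) ≡ a * (d * d)
    expand = solve-∀
    2^[6+2m]∣oddPow*defect² : ∀ t →
      2ℤ ^ ((3 ℕ.+ m) ℕ.+ (3 ℕ.+ m)) ∣ oddPow n t * (defect (+ t) (suc m) * defect (+ t) (suc m))
    2^[6+2m]∣oddPow*defect² t with evenOdd t
    ... | even u rewrite oddIndicator-even u = divides 0ℤ refl
    ... | odd u rewrite +[1+2u]≡1+2ℤ*u u =
      ∣n⇒∣m*n (oddIndicator (suc (2 ℕ.* u)) * (1ℤ + 2ℤ * + u) ^ n) (2^[6+2m]∣defect-odd² u m)

  k!S≡Δ+r*Δodd : ∀ k n m r {E} → E ≤ n ℕ.+ 2 ℕ.^ suc m ℕ.* r → E ≤ (3 ℕ.+ m) ℕ.+ (3 ℕ.+ m) →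
    2ℤ ^ E ∣ + (k ! ℕ.* S (n ℕ.+ 2 ℕ.^ suc m ℕ.* r) k)
             - (Δ k (oddPow n) + + r * Δodd k n (suc m))
  k!S≡Δ+r*Δodd k n m r {E} E≤j E≤2[3+m] =
    subst₂ (λ a b → 2ℤ ^ E ∣ a - b)
      (Δ-pow≡k!S (n ℕ.+ 2 ℕ.^ suc m ℕ.* r) k)
      (Δ-linear k (oddPow n) (λ t → oddPow n t * defect (+ t) (suc m)) (+ r))
      (Δ-cong-∣ k (λ t → oddPow-shift n m r t E≤j E≤2[3+m]))

  Δodd-suc≡2Δodd : ∀ k n m {E} → E ≤ (3 ℕ.+ m) ℕ.+ (3 ℕ.+ m) →
    2ℤ ^ E ∣ Δodd k n (2 ℕ.+ m) - 2ℤ * Δodd k n (suc m)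
  Δodd-suc≡2Δodd k n m {E} E≤2[3+m] =
    subst (λ b → 2ℤ ^ E ∣ Δodd k n (2 ℕ.+ m) - b)
      (Δ-scale k (λ t → oddPow n t * defect (+ t) (suc m)) 2ℤ)
      (Δ-cong-∣ k (λ t → oddPow-defect-suc n m t E≤2[3+m]))

  Δodd-halving : ∀ k n m e → suc e ≤ (3 ℕ.+ m) ℕ.+ (3 ℕ.+ m) →
    (2ℤ ^ suc e ∣ Δodd k n (2 ℕ.+ m)) ⇔ (2ℤ ^ e ∣ Δodd k n (suc m))
  Δodd-halving k n m e 1+e≤2[3+m] = 2P∣x⇔P∣y (2ℤ ^ e) _ _ (Δodd-suc≡2Δodd k n m 1+e≤2[3+m])

  k≤2*ceilHalf : ∀ k → k ≤ 2 ℕ.* ceilHalf k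
  k≤2*ceilHalf k = ℕ.≤-pred (begin
    suc k                        ≡⟨ ℕ.+-comm 1 k ⟩
    k ℕ.+ 1                      ≡⟨ m≡m%n+[m/n]*n (k ℕ.+ 1) 2 ⟩
    (k ℕ.+ 1) ℕ.% 2 ℕ.+ q ℕ.* 2  ≤⟨ ℕ.+-monoˡ-≤ (q ℕ.* 2) (ℕ.≤-pred (m%n<n (k ℕ.+ 1) 2)) ⟩
    suc (q ℕ.* 2)                ≡⟨ cong suc (ℕ.*-comm q 2) ⟩
    suc (2 ℕ.* q)                ∎)
    where
    open ℕ.≤-Reasoning
    q = ceilHalf k

  -1^[2u]≡1 : ∀ u → -1ℤ ^ (2 ℕ.* u) ≡ 1ℤ
  -1^[2u]≡1 u = trans (sym (^-*-assoc -1ℤ 2 u)) (^-zeroˡ u)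

  ∣x⇔∣-1^j*x : ∀ {M} x j → M ∣ x ⇔ M ∣ -1ℤ ^ j * x
  ∣x⇔∣-1^j*x {M} x j =
    mk⇔ (∣n⇒∣m*n σ) (λ M∣σx → subst (M ∣_) σσx≡x (∣n⇒∣m*n σ M∣σx))
    where
    σ = -1ℤ ^ j
    σσx≡x : σ * (σ * x) ≡ x
    σσx≡x = begin
      σ * (σ * x)          ≡⟨ sym (*-assoc σ σ x) ⟩
      σ * σ * x            ≡⟨ cong (_* x) (sym (^-distribˡ-+-* -1ℤ j j)) ⟩
      -1ℤ ^ (j ℕ.+ j) * x  ≡⟨ cong (λ e → -1ℤ ^ (j ℕ.+ e) * x) (sym (ℕ.+-identityʳ j)) ⟩
      -1ℤ ^ (2 ℕ.* j) * x  ≡⟨ cong (_* x) (-1^[2u]≡1 j) ⟩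
      1ℤ * x               ≡⟨ *-identityˡ x ⟩
      x                    ∎
      where open ≡-Reasoning

  -1^[k+1+2u]≡-1^[1+k] : ∀ k u → -1ℤ ^ (k ℕ.+ suc (2 ℕ.* u)) ≡ -1ℤ ^ suc k
  -1^[k+1+2u]≡-1^[1+k] k u = begin
    -1ℤ ^ (k ℕ.+ suc (2 ℕ.* u))      ≡⟨ cong (-1ℤ ^_) (ℕ.+-suc k (2 ℕ.* u)) ⟩
    -1ℤ ^ (suc k ℕ.+ 2 ℕ.* u)        ≡⟨ ^-distribˡ-+-* -1ℤ (suc k) (2 ℕ.* u) ⟩
    -1ℤ ^ suc k * -1ℤ ^ (2 ℕ.* u)    ≡⟨ cong (-1ℤ ^ suc k *_) (-1^[2u]≡1 u) ⟩
    -1ℤ ^ suc k * 1ℤ                 ≡⟨ *-identityʳ (-1ℤ ^ suc k) ⟩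
    -1ℤ ^ suc k                      ∎
    where open ≡-Reasoning

  Δodd≡±f : ∀ k ℓ n → Δodd k n (suc (s k ℓ)) ≡ -1ℤ ^ suc k * f k ℓ n
  Δodd≡±f k ℓ n = begin
    Δ k term
      ≡⟨ Δ-explicit k (suc (2 ℕ.* M)) term (s≤s (k≤2*ceilHalf k)) ⟩
    ∑ (suc (2 ℕ.* M)) (λ i → signedBinomial k i * term i)
      ≡⟨ ∑-odd M (λ i → signedBinomial k i * term i) even-vanishes ⟩
    ∑ M (λ u → signedBinomial k (suc (2 ℕ.* u)) * term (suc (2 ℕ.* u)))
      ≡⟨ ∑-cong M odd-term ⟩
    ∑ M (λ u → -1ℤ ^ suc k * fTerm u)
      ≡⟨ ∑-scale M fTerm (-1ℤ ^ suc k) ⟩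
    -1ℤ ^ suc k * ∑ M fTerm
      ≡⟨ cong (-1ℤ ^ suc k *_) (sym (foldr-map-upTo≡∑ M fTerm)) ⟩
    -1ℤ ^ suc k * f k ℓ n
      ∎
    where
    open ≡-Reasoning
    s′ = s k ℓ
    M = ceilHalf k
    term : ℕ → ℤ
    term t = oddPow n t * defect (+ t) (suc s′)
    fTerm : ℕ → ℤ
    fTerm u = let t = 2 ℕ.* u ℕ.+ 1 in
      + (k C t) * + (t ℕ.^ n) * (+ (t ℕ.^ (2 ℕ.^ (s′ ℕ.+ 1))) - + 1)
    even-vanishes : ∀ u → signedBinomial k (2 ℕ.* u) * term (2 ℕ.* u) ≡ 0ℤ
    even-vanishes u = trans (cong (λ o → signedBinomial k t * (o * (+ t) ^ n * defect (+ t) (suc s′)))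
                                  (oddIndicator-even u))
                            (vanish (signedBinomial k t) ((+ t) ^ n) (defect (+ t) (suc s′)))
      where
      t = 2 ℕ.* u
      vanish : ∀ c a d → c * (0ℤ * a * d) ≡ 0ℤ
      vanish = solve-∀
    odd-term : ∀ u → signedBinomial k (suc (2 ℕ.* u)) * term (suc (2 ℕ.* u)) ≡ -1ℤ ^ suc k * fTerm u
    odd-term u = begin
      signedBinomial k t * (oddIndicator t * (+ t) ^ n * defect (+ t) (suc s′))
        ≡⟨ cong₂ (λ σ o → σ * + (k C t) * (o * (+ t) ^ n * defect (+ t) (suc s′)))
                 (-1^[k+1+2u]≡-1^[1+k] k u) (oddIndicator-odd u) ⟩
      -1ℤ ^ suc k * + (k C t) * (1ℤ * (+ t) ^ n * defect (+ t) (suc s′))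
        ≡⟨ rearrange (-1ℤ ^ suc k) (+ (k C t)) ((+ t) ^ n) (defect (+ t) (suc s′)) ⟩
      -1ℤ ^ suc k * (+ (k C t) * (+ t) ^ n * defect (+ t) (suc s′))
        ≡⟨ cong (-1ℤ ^ suc k *_) (sym fTerm-odd) ⟩
      -1ℤ ^ suc k * fTerm u
        ∎
      where
      t = suc (2 ℕ.* u)
      rearrange : ∀ σ c a d → σ * c * (1ℤ * a * d) ≡ σ * (c * a * d)
      rearrange = solve-∀
      fTerm-odd : fTerm u ≡ + (k C t) * (+ t) ^ n * defect (+ t) (suc s′)
      fTerm-odd = trans
        (cong₂ (λ t e → + (k C t) * + (t ℕ.^ n) * (+ (t ℕ.^ (2 ℕ.^ e)) - 1ℤ))
               (ℕ.+-comm (2 ℕ.* u) 1) (ℕ.+-comm s′ 1))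
        (cong₂ (λ a b → + (k C t) * a * (b - 1ℤ)) (pos-^ t n) (pos-^ t (2 ℕ.^ suc s′)))

module Valuation where
  open import Data.Nat
  open import Data.Nat.Properties
  open import Data.Nat.Divisibility
  open import Data.Nat.DivMod using (_/_; m/n*n≡m; m/n<m; m≥n⇒m/n>0)
  open import Data.Nat.Primality using (prime[2]; euclidsLemma)
  open import Data.Nat.Logarithm using (⌈log₂_⌉; ⌈log₂⌉-mono-≤; ⌈log₂2^n⌉≡n)
  open import Data.Nat.Tactic.RingSolver using (solve-∀)
  open import Data.Product using (_×_; _,_; ∃-syntax)
  open import Data.Sum using (inj₁; inj₂)
  open import Relation.Nullary using (¬_; Dec; does; yes; no; contradiction)
  open import Data.Bool using (if_then_else_)
  open import Function using (_⇔_; mk⇔)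
  open import Relation.Binary.PropositionalEquality
  open import Defs using (ν₂-fuel; ν₂; b)

  ν₂-fuel-spec : ∀ fuel z → z ≤ fuel → 0 < z → ∃[ o ] z ≡ 2 ^ ν₂-fuel fuel z * o × ¬ 2 ∣ o
  ν₂-fuel-spec (suc fuel) (suc z) z≤fuel _ = step (2 ∣? suc z)
    where
    -- `with 2 ∣? suc z` cannot abstract the decision: the goal only contains its reduct.
    step : (d : Dec (2 ∣ suc z)) →
      ∃[ o ] suc z ≡ 2 ^ (if does d then suc (ν₂-fuel fuel (suc z / 2)) else 0) * o × ¬ 2 ∣ o
    step (no 2∤z)  = suc z , sym (*-identityˡ (suc z)) , 2∤z
    step (yes 2∣z) with ν₂-fuel-spec fuel (suc z / 2) half≤fuel (m≥n⇒m/n>0 (∣⇒≤ 2∣z))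
      where
      half≤fuel : suc z / 2 ≤ fuel
      half≤fuel = ≤-pred (≤-trans (m/n<m (suc z) 2 (s≤s (s≤s z≤n))) z≤fuel)
    ... | o , half≡ , 2∤o = o , (begin
      suc z                                   ≡⟨ sym (m/n*n≡m 2∣z) ⟩
      suc z / 2 * 2                           ≡⟨ cong (_* 2) half≡ ⟩
      2 ^ ν₂-fuel fuel (suc z / 2) * o * 2    ≡⟨ double (2 ^ ν₂-fuel fuel (suc z / 2)) o ⟩
      2 * 2 ^ ν₂-fuel fuel (suc z / 2) * o    ∎) , 2∤o
      where
      open ≡-Reasoning
      double : ∀ p o → p * o * 2 ≡ 2 * p * o
      double = solve-∀

  k!≡2^ν₂*odd : ∀ k → ∃[ o ] k ! ≡ 2 ^ ν₂ (k !) * o × ¬ 2 ∣ o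
  k!≡2^ν₂*odd k = ν₂-fuel-spec (k !) (k !) ≤-refl (1≤n! k)

  2^Q∣o*x⇒2^Q∣x : ∀ Q {o x} → ¬ 2 ∣ o → 2 ^ Q ∣ o * x → 2 ^ Q ∣ x
  2^Q∣o*x⇒2^Q∣x zero    {x = x} _ _ = 1∣ x
  2^Q∣o*x⇒2^Q∣x (suc Q) {o} {x} 2∤o 2^[1+Q]∣o*x
    with euclidsLemma o x prime[2] (∣-trans (∣m⇒∣m*n (2 ^ Q) ∣-refl) 2^[1+Q]∣o*x)
  ... | inj₁ 2∣o = contradiction 2∣o 2∤o
  ... | inj₂ (divides y refl) =
    subst (2 ^ suc Q ∣_) (*-comm 2 y)
      (*-monoʳ-∣ 2 (2^Q∣o*x⇒2^Q∣x Q 2∤o (*-cancelˡ-∣ 2 2*2^Q∣2*[o*y])))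
    where
    regroup : ∀ o y → o * (y * 2) ≡ 2 * (o * y)
    regroup = solve-∀
    2*2^Q∣2*[o*y] : 2 * 2 ^ Q ∣ 2 * (o * y)
    2*2^Q∣2*[o*y] = subst (2 ^ suc Q ∣_) (regroup o y) 2^[1+Q]∣o*x

  2^Q∣x⇔2^[v+Q]∣2^v*o*x : ∀ v Q {o x} → ¬ 2 ∣ o → (2 ^ Q ∣ x) ⇔ (2 ^ (v + Q) ∣ 2 ^ v * o * x)
  2^Q∣x⇔2^[v+Q]∣2^v*o*x v Q {o} {x} 2∤o = mk⇔
    (λ 2^Q∣x → subst₂ _∣_ (sym split) (sym (*-assoc (2 ^ v) o x))
      (*-monoʳ-∣ (2 ^ v) (∣n⇒∣m*n o 2^Q∣x)))
    (λ 2^[v+Q]∣ → 2^Q∣o*x⇒2^Q∣x Q 2∤o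
      (*-cancelˡ-∣ (2 ^ v) {{m^n≢0 2 v}} (subst₂ _∣_ split (*-assoc (2 ^ v) o x) 2^[v+Q]∣)))
    where
    split : 2 ^ (v + Q) ≡ 2 ^ v * 2 ^ Q
    split = ^-distribˡ-+-* 2 v Q

  2^c∣2^v*o⇒c≤v : ∀ c v {o} → ¬ 2 ∣ o → 2 ^ c ∣ 2 ^ v * o → c ≤ v
  2^c∣2^v*o⇒c≤v c v {o} 2∤o 2^c∣ with c ≤? v
  ... | yes c≤v = c≤v
  ... | no  c≰v = contradiction
    (*-cancelˡ-∣ (2 ^ v) {{m^n≢0 2 v}}
      (subst (_∣ 2 ^ v * o) (*-comm 2 (2 ^ v)) (∣-trans (2^-mono-∣ (≰⇒> c≰v)) 2^c∣)))
    2∤o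
    where
    2^-mono-∣ : ∀ {e e′} → e ≤ e′ → 2 ^ e ∣ 2 ^ e′
    2^-mono-∣ z≤n        = 1∣ _
    2^-mono-∣ (s≤s e≤e′) = *-monoʳ-∣ 2 (2^-mono-∣ e≤e′)

  2^n*n!∣[2n]! : ∀ n → 2 ^ n * n ! ∣ (2 * n) !
  2^n*n!∣[2n]! zero    = ∣-refl
  2^n*n!∣[2n]! (suc n) = subst₂ _∣_ (regroup n (2 ^ n) (n !)) (cong _! (sym (*-suc 2 n)))
    (*-monoʳ-∣ (2 + 2 * n) (∣n⇒∣m*n (suc (2 * n)) (2^n*n!∣[2n]! n)))
    where
    regroup : ∀ n p f → (2 + 2 * n) * (p * f) ≡ 2 * p * ((1 + n) * f)
    regroup = solve-∀

  2^[2^c]∣2*[2^c]! : ∀ c → 2 ^ (2 ^ c) ∣ 2 * (2 ^ c) !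
  2^[2^c]∣2*[2^c]! zero    = ∣-refl
  2^[2^c]∣2*[2^c]! (suc c) = subst (_∣ 2 * (2 * N) !) (sym square)
    (∣-trans (*-monoʳ-∣ (2 ^ N) (2^[2^c]∣2*[2^c]! c))
             (subst (_∣ 2 * (2 * N) !) (sym (regroup (2 ^ N) (N !))) (*-monoʳ-∣ 2 (2^n*n!∣[2n]! N))))
    where
    N = 2 ^ c
    square : 2 ^ (2 * N) ≡ 2 ^ N * 2 ^ N
    square = trans (cong (2 ^_) (cong (N +_) (+-identityʳ N))) (^-distribˡ-+-* 2 N N)
    regroup : ∀ p f → p * (2 * f) ≡ 2 * (p * f)
    regroup = solve-∀

  2*c≤2^c : ∀ c → 2 * c ≤ 2 ^ c
  2*c≤2^c zero          = z≤n
  2*c≤2^c (suc zero)    = ≤-refl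
  2*c≤2^c (suc (suc c)) = begin
    2 * suc (suc c)            ≡⟨ *-suc 2 (suc c) ⟩
    2 + 2 * suc c              ≤⟨ +-mono-≤ (*-monoʳ-≤ 2 (m^n>0 2 c)) (2*c≤2^c (suc c)) ⟩
    2 ^ suc c + 2 ^ suc c      ≡⟨ cong (2 ^ suc c +_) (sym (+-identityʳ (2 ^ suc c))) ⟩
    2 * 2 ^ suc c              ∎
    where open ≤-Reasoning

  ⌈log₂k⌉≡2+b : ∀ {k} → 5 ≤ k → ⌈log₂ k ⌉ ≡ 2 + b k
  ⌈log₂k⌉≡2+b {k} 5≤k =
    trans (sym (m∸n+n≡m (≤-trans (s≤s (s≤s z≤n)) (⌈log₂⌉-mono-≤ 5≤k)))) (+-comm (b k) 2)

  1≤b : ∀ {k} → 5 ≤ k → 1 ≤ b k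
  1≤b 5≤k = ∸-monoˡ-≤ 2 (⌈log₂⌉-mono-≤ 5≤k)

  2^[1+b]≤k : ∀ {k} → 5 ≤ k → 2 ^ suc (b k) ≤ k
  2^[1+b]≤k {k} 5≤k with 2 ^ suc (b k) ≤? k
  ... | yes 2^[1+b]≤k = 2^[1+b]≤k
  ... | no  2^[1+b]≰k = contradiction
    (subst₂ _≤_ (⌈log₂k⌉≡2+b 5≤k) (⌈log₂2^n⌉≡n (suc (b k)))
      (⌈log₂⌉-mono-≤ (<⇒≤ (≰⇒> 2^[1+b]≰k))))
    (<-irrefl refl)

  1+2b≤ν₂[k!] : ∀ {k} → 5 ≤ k → suc (2 * b k) ≤ ν₂ (k !)
  1+2b≤ν₂[k!] {k} 5≤k with k!≡2^ν₂*odd k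
  ... | o , k!≡ , 2∤o = ≤-pred (begin
    suc (suc (2 * b k))  ≡⟨ sym (*-suc 2 (b k)) ⟩
    2 * c                ≤⟨ 2*c≤2^c c ⟩
    2 ^ c                ≤⟨ 2^c∣2^v*o⇒c≤v (2 ^ c) (suc v) 2∤o 2^[2^c]∣2^[1+v]*o ⟩
    suc v                ∎)
    where
    open ≤-Reasoning
    c = suc (b k)
    v = ν₂ (k !)
    2*k!≡2^[1+v]*o : 2 * k ! ≡ 2 ^ suc v * o
    2*k!≡2^[1+v]*o = trans (cong (2 *_) k!≡) (sym (*-assoc 2 (2 ^ v) o))
    2^[2^c]∣2^[1+v]*o : 2 ^ (2 ^ c) ∣ 2 ^ suc v * o
    2^[2^c]∣2^[1+v]*o = ∣-trans (2^[2^c]∣2*[2^c]! c)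
      (subst (2 * (2 ^ c) ! ∣_) 2*k!≡2^[1+v]*o (*-monoʳ-∣ 2 (m≤n⇒m!∣n! (2^[1+b]≤k 5≤k))))

module StirlingClasses where
  open import Data.Integer using (ℤ; +_; _+_; _-_; _*_; _^_; 1ℤ; ∣_∣)
  open import Data.Integer.Properties using (pos-+; pos-*; abs-*; m-n≡m⊖n; ⊖-≥)
  import Data.Integer.Divisibility as Unsigned
  open import Data.Integer.Divisibility.Signed
    using (_∣_; ∣ᵤ⇒∣; ∣⇒∣ᵤ; ∣m∣n⇒∣m+n; ∣m∣n⇒∣m-n; ∣n⇒∣m*n)
  open import Data.Integer.Tactic.RingSolver using (solve-∀)
  import Data.Nat as ℕ
  open ℕ using (ℕ; suc; _!; _≤_)
  import Data.Nat.Properties as ℕ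
  import Data.Nat.Divisibility as ℕ
  open import Data.Product using (_,_; ∃-syntax)
  open import Relation.Nullary using (¬_)
  open import Function using (_⇔_; mk⇔; Equivalence)
  import Function.Properties.Equivalence as ⇔
  open import Relation.Binary.PropositionalEquality
  open import Defs using (S; _≡_[mod_]; _∈[_]_; ConstMod)
  open FiniteDifferences
  open TwoAdic
  open Valuation using (2^Q∣x⇔2^[v+Q]∣2^v*o*x)
  open OddDifferences

  ∈[n]t⇒≡n+t*r : ∀ {j n t} → j ∈[ n ] t → ∃[ r ] j ≡ n ℕ.+ t ℕ.* r
  ∈[n]t⇒≡n+t*r {j} {n} {t} (n⊔t≤j , t∣j-n) = quotient , (begin
    j                         ≡⟨ sym (ℕ.m+[n∸m]≡n n≤j) ⟩
    n ℕ.+ (j ℕ.∸ n)           ≡⟨ cong (n ℕ.+_) equality ⟩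
    n ℕ.+ quotient ℕ.* t      ≡⟨ cong (n ℕ.+_) (ℕ.*-comm quotient t) ⟩
    n ℕ.+ t ℕ.* quotient      ∎)
    where
    open ≡-Reasoning
    n≤j : n ≤ j
    n≤j = ℕ.≤-trans (ℕ.m≤m⊔n n t) n⊔t≤j
    t∣j∸n : t ℕ.∣ j ℕ.∸ n
    t∣j∸n = subst (t ℕ.∣_) (cong ∣_∣ (trans (m-n≡m⊖n j n) (⊖-≥ n≤j))) t∣j-n
    open ℕ._∣_ t∣j∸n

  n+t*[1+r]∈[n]t : ∀ n t r → (n ℕ.+ t ℕ.* suc r) ∈[ n ] t
  n+t*[1+r]∈[n]t n t r =
    n⊔t≤j , subst (λ z → t ℕ.∣ ∣ z ∣) (sym j-n≡t*[1+r]) (ℕ.divides (suc r) (ℕ.*-comm t (suc r)))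
    where
    j = n ℕ.+ t ℕ.* suc r
    n⊔t≤j : n ℕ.⊔ t ≤ j
    n⊔t≤j = ℕ.⊔-lub (ℕ.m≤m+n n (t ℕ.* suc r))
                    (ℕ.≤-trans (ℕ.m≤m*n t (suc r)) (ℕ.m≤n+m (t ℕ.* suc r) n))
    cancel : ∀ a b → a + b - a ≡ b
    cancel = solve-∀
    j-n≡t*[1+r] : + j - + n ≡ + (t ℕ.* suc r)
    j-n≡t*[1+r] = trans (cong (_- + n) (pos-+ n (t ℕ.* suc r))) (cancel (+ n) (+ (t ℕ.* suc r)))

  2^Q∣X⇔2^[v+Q]∣2^v*o*X : ∀ v Q {o} X → ¬ 2 ℕ.∣ o →
    (+ (2 ℕ.^ Q) Unsigned.∣ X) ⇔ (2ℤ ^ (v ℕ.+ Q) ∣ + (2 ℕ.^ v ℕ.* o) * X)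
  2^Q∣X⇔2^[v+Q]∣2^v*o*X v Q {o} X 2∤o =
    ⇔.trans (2^Q∣x⇔2^[v+Q]∣2^v*o*x v Q 2∤o)
      (subst₂ (λ a M → (2 ℕ.^ (v ℕ.+ Q) ℕ.∣ a) ⇔ (M ∣ + (2 ℕ.^ v ℕ.* o) * X))
        (abs-* (+ (2 ℕ.^ v ℕ.* o)) X) (pos-^ 2 (v ℕ.+ Q)) (mk⇔ ∣ᵤ⇒∣ ∣⇒∣ᵤ))

  constMod⇔2^E∣Δodd : ∀ k n m v Q {o} → k ! ≡ 2 ℕ.^ v ℕ.* o → ¬ 2 ℕ.∣ o →
    v ℕ.+ Q ≤ 2 ℕ.^ suc m → v ℕ.+ Q ≤ (3 ℕ.+ m) ℕ.+ (3 ℕ.+ m) →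
    ConstMod n (2 ℕ.^ suc m) k (2 ℕ.^ Q) ⇔ (2ℤ ^ (v ℕ.+ Q) ∣ Δodd k n (suc m))
  constMod⇔2^E∣Δodd k n m v Q {o} k!≡2^v*o 2∤o E≤T E≤2[3+m] = mk⇔ to from
    where
    T = 2 ℕ.^ suc m
    E = v ℕ.+ Q
    A = Δ k (oddPow n)
    g = Δodd k n (suc m)

    k!S : ℕ → ℤ
    k!S j = + (k ! ℕ.* S j k)

    ≡[mod2^Q]⇔2^E∣k!S-k!S : ∀ j j′ →
      (S j k ≡ S j′ k [mod 2 ℕ.^ Q ]) ⇔ (2ℤ ^ E ∣ k!S j - k!S j′)
    ≡[mod2^Q]⇔2^E∣k!S-k!S j j′ =
      subst (λ z → (S j k ≡ S j′ k [mod 2 ℕ.^ Q ]) ⇔ (2ℤ ^ E ∣ z)) scale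
        (2^Q∣X⇔2^[v+Q]∣2^v*o*X v Q (+ S j k - + S j′ k) 2∤o)
      where
      distrib : ∀ c a b → c * (a - b) ≡ c * a - c * b
      distrib = solve-∀
      scale : + (2 ℕ.^ v ℕ.* o) * (+ S j k - + S j′ k) ≡ k!S j - k!S j′
      scale = trans (cong (λ c → + c * (+ S j k - + S j′ k)) (sym k!≡2^v*o))
        (trans (distrib (+ (k !)) (+ S j k) (+ S j′ k))
               (sym (cong₂ _-_ (pos-* (k !) (S j k)) (pos-* (k !) (S j′ k)))))

    k!S≡A+r*g : ∀ r → E ≤ n ℕ.+ T ℕ.* r → 2ℤ ^ E ∣ k!S (n ℕ.+ T ℕ.* r) - (A + + r * g)
    k!S≡A+r*g r E≤j = k!S≡Δ+r*Δodd k n m r E≤j E≤2[3+m]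

    E≤n+T*[1+r] : ∀ r → E ≤ n ℕ.+ T ℕ.* suc r
    E≤n+T*[1+r] r = ℕ.≤-trans E≤T (ℕ.≤-trans (ℕ.m≤m*n T (suc r)) (ℕ.m≤n+m (T ℕ.* suc r) n))

    E≤j : ∀ {j} → j ∈[ n ] T → E ≤ j
    E≤j (n⊔T≤j , _) = ℕ.≤-trans E≤T (ℕ.≤-trans (ℕ.m≤n⊔m n T) n⊔T≤j)

    to : ConstMod n T k (2 ℕ.^ Q) → 2ℤ ^ E ∣ g
    to const = subst (2ℤ ^ E ∣_) (isolate (k!S j₂) (k!S j₁) A g)
      (∣m∣n⇒∣m-n (Equivalence.to (≡[mod2^Q]⇔2^E∣k!S-k!S j₂ j₁) S₂≡S₁)
                 (∣m∣n⇒∣m-n (k!S≡A+r*g 2 (E≤n+T*[1+r] 1)) (k!S≡A+r*g 1 (E≤n+T*[1+r] 0))))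
      where
      j₁ = n ℕ.+ T ℕ.* 1
      j₂ = n ℕ.+ T ℕ.* 2
      S₂≡S₁ = const j₂ j₁ (n+t*[1+r]∈[n]t n T 1) (n+t*[1+r]∈[n]t n T 0)
      isolate : ∀ X₂ X₁ A g → (X₂ - X₁) - ((X₂ - (A + 2ℤ * g)) - (X₁ - (A + 1ℤ * g))) ≡ g
      isolate = solve-∀

    from : 2ℤ ^ E ∣ g → ConstMod n T k (2 ℕ.^ Q)
    from 2^E∣g j j′ j∈ j′∈ with ∈[n]t⇒≡n+t*r {n = n} {T} j∈ | ∈[n]t⇒≡n+t*r {n = n} {T} j′∈
    ... | r , refl | r′ , refl = Equivalence.from (≡[mod2^Q]⇔2^E∣k!S-k!S j j′)
      (subst (2ℤ ^ E ∣_) (combine (k!S j) (k!S j′) A g (+ r) (+ r′))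
        (∣m∣n⇒∣m+n (∣m∣n⇒∣m-n (k!S≡A+r*g r (E≤j j∈)) (k!S≡A+r*g r′ (E≤j j′∈)))
                   (∣n⇒∣m*n (+ r - + r′) 2^E∣g)))
      where
      combine : ∀ X X′ A g r r′ → (X - (A + r * g)) - (X′ - (A + r′ * g)) + (r - r′) * g ≡ X - X′
      combine = solve-∀

module ExponentArithmetic where
  open import Data.Nat
  open import Data.Nat.Properties
  open import Data.Nat.Tactic.RingSolver using (solve-∀)
  open import Data.Product using (_,_)
  open import Relation.Binary.PropositionalEquality

  ≤-offset : ∀ {m n} d → m + d ≡ n → m ≤ n
  ≤-offset {m} d refl = m≤m+n m d

  b+3≤v+ℓ : ∀ {b v ℓ} → 1 ≤ b → suc (2 * b) ≤ v → 1 ≤ ℓ → b + 3 ≤ v + ℓ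
  b+3≤v+ℓ {suc b} {v} {suc ℓ} _ 1+2b≤v _ with m≤n⇒∃[o]m+o≡n 1+2b≤v
  ... | x , refl = ≤-offset (b + x + ℓ) (regroup b x ℓ)
    where
    regroup : ∀ b x ℓ → suc b + 3 + (b + x + ℓ) ≡ suc (2 * suc b) + x + suc ℓ
    regroup = solve-∀

  b≤1+s : ∀ {b v ℓ s} → s + (b + 3) ≡ v + ℓ → suc (2 * b) ≤ v → 1 ≤ ℓ → b ≤ suc s
  b≤1+s {b} {v} {suc ℓ} {s} s+b+3≡v+ℓ 1+2b≤v _ with m≤n⇒∃[o]m+o≡n 1+2b≤v
  ... | x , refl = ≤-offset (x + ℓ) (sym (+-cancelˡ-≡ (b + 2) (suc s) (b + (x + ℓ))
      (trans (regroupˡ b s) (trans s+b+3≡v+ℓ (regroupʳ b x ℓ)))))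
    where
    regroupˡ : ∀ b s → b + 2 + suc s ≡ s + (b + 3)
    regroupˡ = solve-∀
    regroupʳ : ∀ b x ℓ → suc (2 * b) + x + suc ℓ ≡ b + 2 + (b + (x + ℓ))
    regroupʳ = solve-∀

  exponent-identity : ∀ {v ℓ b s} m → s + (b + 3) ≡ v + ℓ → b ≤ m + ℓ →
    v + ((m + ℓ) ∸ b) ≡ m + (s + 3)
  exponent-identity {v} {ℓ} {b} {s} m s+b+3≡v+ℓ b≤m+ℓ = +-cancelʳ-≡ b _ _ (begin
    v + ((m + ℓ) ∸ b) + b    ≡⟨ +-assoc v ((m + ℓ) ∸ b) b ⟩
    v + ((m + ℓ) ∸ b + b)    ≡⟨ cong (v +_) (m∸n+n≡m b≤m+ℓ) ⟩
    v + (m + ℓ)              ≡⟨ swap v m ℓ ⟩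
    m + (v + ℓ)              ≡⟨ cong (m +_) (sym s+b+3≡v+ℓ) ⟩
    m + (s + (b + 3))        ≡⟨ regroup m s b ⟩
    m + (s + 3) + b          ∎)
    where
    open ≡-Reasoning
    swap : ∀ v m ℓ → v + (m + ℓ) ≡ m + (v + ℓ)
    swap = solve-∀
    regroup : ∀ m s b → m + (s + (b + 3)) ≡ m + (s + 3) + b
    regroup = solve-∀

open import Data.Nat using (ℕ; _≤_)

module Proposition (k ℓ : ℕ) (5≤k : 5 ≤ k) (1≤ℓ : 1 ≤ ℓ) (n : ℕ) where
  import Data.Integer as ℤ
  open ℤ using (+_)
  import Data.Integer.Divisibility as Unsigned
  open import Data.Integer.Divisibility.Signed using (_∣_; ∣ᵤ⇒∣; ∣⇒∣ᵤ)
  open import Data.Nat using (zero; suc; _+_; _*_; _∸_; _^_; _!; s≤s)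
  open import Data.Nat.Properties using (≤-trans; m≤m+n; m≤n+m; m∸n+n≡m; m≤n⇒∃[o]m+o≡n)
  open import Data.Nat.Tactic.RingSolver using (solve-∀)
  open import Data.Product using (_,_; proj₂; ∃-syntax)
  open import Function using (_⇔_; mk⇔)
  import Function.Properties.Equivalence as ⇔
  open import Relation.Binary.PropositionalEquality
  open import Defs using (s; b; ν₂; f; ConstMod; Admissible)
  open TwoAdic using (2ℤ; pos-^)
  open Valuation using (k!≡2^ν₂*odd; 1≤b; 1+2b≤ν₂[k!]; 2*c≤2^c)
  open OddDifferences using (Δodd; Δodd-halving; Δodd≡±f; ∣x⇔∣-1^j*x)
  open StirlingClasses using (constMod⇔2^E∣Δodd)
  open ExponentArithmetic

  private
    v = ν₂ (k !)
    s₀ = s k ℓ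
    b₀ = b k

  s+b+3≡v+ℓ : s₀ + (b₀ + 3) ≡ v + ℓ
  s+b+3≡v+ℓ = m∸n+n≡m (b+3≤v+ℓ (1≤b 5≤k) (1+2b≤ν₂[k!] 5≤k) 1≤ℓ)

  Cond : ℕ → Set
  Cond m = 2ℤ ℤ.^ (m + (s₀ + 3)) ∣ Δodd k n m

  Cond-stable : ∀ d → Cond (suc (d + s₀)) ⇔ Cond (suc s₀)
  Cond-stable zero    = ⇔.refl
  Cond-stable (suc d) =
    ⇔.trans (Δodd-halving k n (d + s₀) (suc (d + s₀) + (s₀ + 3)) (≤-offset (suc d) (bound d s₀)))
            (Cond-stable d)
    where
    bound : ∀ d s → suc (suc (d + s) + (s + 3)) + suc d ≡ (3 + (d + s)) + (3 + (d + s))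
    bound = solve-∀

  admissible⇒≡1+d+s : ∀ {m} → Admissible k ℓ m → ∃[ d ] m ≡ suc (d + s₀)
  admissible⇒≡1+d+s (1+s≤m , _) with m≤n⇒∃[o]m+o≡n 1+s≤m
  ... | d , s+1+d≡m = d , trans (sym s+1+d≡m) (regroup s₀ d)
    where
    regroup : ∀ s d → s + 1 + d ≡ suc (d + s)
    regroup = solve-∀

  constMod⇔Cond : ∀ m → Admissible k ℓ m →
    ConstMod n (2 ^ m) k (2 ^ ((m + ℓ) ∸ b₀)) ⇔ Cond (suc s₀)
  constMod⇔Cond m adm with admissible⇒≡1+d+s adm | k!≡2^ν₂*odd k
  ... | d , refl | o , k!≡2^v*o , 2∤o =
    ⇔.trans (subst (λ E → ConstMod n (2 ^ m) k (2 ^ Q) ⇔ (2ℤ ℤ.^ E ∣ Δodd k n m)) E≡m+s+3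
                   (constMod⇔2^E∣Δodd k n (d + s₀) v Q k!≡2^v*o 2∤o E≤2^m E≤2[3+m]))
            (Cond-stable d)
    where
    Q = (m + ℓ) ∸ b₀
    b≤m+ℓ : b₀ ≤ m + ℓ
    b≤m+ℓ = ≤-trans (b≤1+s s+b+3≡v+ℓ (1+2b≤ν₂[k!] 5≤k) 1≤ℓ)
                    (≤-trans (s≤s (m≤n+m s₀ d)) (m≤m+n m ℓ))
    E≡m+s+3 : v + Q ≡ m + (s₀ + 3)
    E≡m+s+3 = exponent-identity m s+b+3≡v+ℓ b≤m+ℓ
    E≤2^m : v + Q ≤ 2 ^ m
    E≤2^m = subst (_≤ 2 ^ m) (sym E≡m+s+3) (proj₂ adm)
    bound : ∀ d s → suc (d + s) + (s + 3) + (2 + d) ≡ (3 + (d + s)) + (3 + (d + s))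
    bound = solve-∀
    E≤2[3+m] : v + Q ≤ (3 + (d + s₀)) + (3 + (d + s₀))
    E≤2[3+m] = subst (_≤ (3 + (d + s₀)) + (3 + (d + s₀))) (sym E≡m+s+3)
                     (≤-offset (2 + d) (bound d s₀))

  f-divisible⇔Cond : (+ (2 ^ (2 * s₀ + 4)) Unsigned.∣ f k ℓ n) ⇔ Cond (suc s₀)
  f-divisible⇔Cond = ⇔.trans (mk⇔ ∣ᵤ⇒∣ ∣⇒∣ᵤ)
    (subst₂ (λ M x → (+ (2 ^ (2 * s₀ + 4)) ∣ f k ℓ n) ⇔ (M ∣ x))
      (trans (pos-^ 2 (2 * s₀ + 4)) (cong (2ℤ ℤ.^_) (regroup s₀))) (sym (Δodd≡±f k ℓ n))
      (∣x⇔∣-1^j*x (f k ℓ n) (suc k)))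
    where
    regroup : ∀ s → 2 * s + 4 ≡ suc s + (s + 3)
    regroup = solve-∀

  m₀ : ℕ
  m₀ = 3 + s₀

  admissible-m₀ : Admissible k ℓ m₀
  admissible-m₀ = ≤-offset 2 (regroup₁ s₀) , subst (_≤ 2 ^ m₀) (regroup₂ s₀) (2*c≤2^c m₀)
    where
    regroup₁ : ∀ s → s + 1 + 2 ≡ 3 + s
    regroup₁ = solve-∀
    regroup₂ : ∀ s → 2 * (3 + s) ≡ 3 + s + (s + 3)
    regroup₂ = solve-∀

open import Defs
open import Data.Nat using (_+_; _*_; _∸_; _^_)
open import Data.Integer using (+_)
open import Data.Integer.Divisibility using (_∣_)
open import Data.Product using (_×_; ∃-syntax; _,_)
open import Function.Bundles using (_⇔_; mk⇔; Equivalence)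
open Equivalence using (to; from)

proposition5p2 : (k ℓ : ℕ) → 5 ≤ k → 1 ≤ ℓ → (n : ℕ) → k ≤ n →
    ((+ (2 ^ (2 * s k ℓ + 4)) ∣ f k ℓ n)
      ⇔ (∀ m → Admissible k ℓ m → ConstMod n (2 ^ m) k (2 ^ ((m + ℓ) ∸ b k))))
    × ((∀ m → Admissible k ℓ m → ConstMod n (2 ^ m) k (2 ^ ((m + ℓ) ∸ b k)))
      ⇔ (∃[ m ] (Admissible k ℓ m × ConstMod n (2 ^ m) k (2 ^ ((m + ℓ) ∸ b k)))))
proposition5p2 k ℓ 5≤k 1≤ℓ n _ =
  mk⇔ (λ f-div m adm → from (constMod⇔Cond m adm) (to f-divisible⇔Cond f-div))
      (λ all → from f-divisible⇔Cond (to (constMod⇔Cond m₀ admissible-m₀) (all m₀ admissible-m₀))) ,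
  mk⇔ (λ all → m₀ , admissible-m₀ , all m₀ admissible-m₀)
      (λ (m , adm , const) m′ adm′ → from (constMod⇔Cond m′ adm′) (to (constMod⇔Cond m adm) const))
  where open Proposition k ℓ 5≤k 1≤ℓ n
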